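{- For every natural number $n$ and every natural number $k$, \[ \sum_{i=0}^{2^k-1} \left\lfloor \frac{n+i}{2^{k+1}} \right\rfloor \;=\; \frac{n}{2} - 2^k \, \mathrm{Zigzag}\!\left(\frac{n}{2^{k+1}}\right). \]
   Context: For a real number $x$, $\mathrm{Zigzag}(x) = \min\left(x - \lfloor x \rfloor,\ \lceil x \rceil - x\right)$. -}

module Defs where

open import Data.Nat using (ℕ; zero; suc; _+_; _^_; NonZero)
open import Data.Integer using (ℤ)
import Data.Rational as ℚ
open ℚ using (ℚ; _-_; _⊓_; floor; ceiling)

Zigzag : ℚ → ℚ
Zigzag x = (x - (floor x ℚ./ 1)) ⊓ ((ceiling x ℚ./ 1) - x)

sumTo : ℕ → (ℕ → ℕ) → ℕ
sumTo zero    f = 0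
sumTo (suc m) f = sumTo m f + f m

-- Write M = 2h with h = 2^k, and n = qM + r with r < M. For i < h we have r + i < 2M, so
-- ⌊(n+i)/M⌋ is q, or q + 1 exactly when i ≥ M − r; hence the sum is hq + (r − h)⁺.
-- On the other side n/M lies at distance r/M above its floor and (M − r)/M below its
-- ceiling (or 0 when r = 0), so Zigzag(n/M) is r/M if 2r ≤ M and (M − r)/M otherwise.
-- In both cases n/2 − h·Zigzag(n/M) = hq + r/2 − h·Zigzag(n/M) = hq + (r − h)⁺.
module Submission where

open import Defs
open import Data.Nat using (ℕ; _+_; _*_; _^_; _/_)
open import Data.Nat.Properties using (m^n≢0)
open import Data.Integer using (+_)
open import Relation.Binary.PropositionalEquality using (_≡_)
import Data.Rational as ℚ

open import Data.Nat using (zero; suc; _∸_; _%_; _≤_; _<_; NonZero)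
import Data.Nat.Properties as ℕ
import Data.Nat.DivMod as ℕ
open import Data.Nat.Divisibility using (divides; m%n≡0⇒n∣m)
open import Algebra.Properties.CommutativeSemigroup ℕ.+-commutativeSemigroup
  using (interchange; xy∙z≈xz∙y)
open import Data.Integer as ℤ using (-[1+_])
import Data.Integer.Properties as ℤ
import Data.Integer.DivMod as ℤ
open import Data.Integer.Tactic.RingSolver using (solve-∀)
import Data.Nat.Tactic.RingSolver as ℕ
open ℚ using (ℚ; mkℚ; floor; ceiling; ↥_; ↧_; toℚᵘ)
import Data.Rational.Properties as ℚ
open import Data.Rational.Unnormalised as ℚᵘ using (mkℚᵘ; *≡*; *≤*; _≃_)
import Data.Rational.Unnormalised.Properties as ℚᵘ
open import Relation.Binary.PropositionalEquality
  using (_≢_; refl; sym; trans; cong; cong₂; subst; subst₂; module ≡-Reasoning)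
open import Relation.Nullary using (Dec; yes; no; contradiction)
open import Function using (_∘_)

[m+i]/n≡m/n+[m%n+i]/n : ∀ m i n .{{_ : NonZero n}} → (m + i) / n ≡ m / n + (m % n + i) / n
[m+i]/n≡m/n+[m%n+i]/n m i n = begin
  (m + i) / n                     ≡⟨ ℕ./-congˡ (cong (_+ i) (ℕ.m≡m%n+[m/n]*n m n)) ⟩
  (m % n + m / n * n + i) / n     ≡⟨ ℕ./-congˡ (xy∙z≈xz∙y (m % n) (m / n * n) i) ⟩
  (m % n + i + m / n * n) / n     ≡⟨ ℕ.+-distrib-/-∣ʳ (m % n + i) (divides (m / n) refl) ⟩
  (m % n + i) / n + m / n * n / n ≡⟨ cong (_+_ ((m % n + i) / n)) (ℕ.m*n/n≡m (m / n) n) ⟩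
  (m % n + i) / n + m / n         ≡⟨ ℕ.+-comm _ (m / n) ⟩
  m / n + (m % n + i) / n         ∎
  where open ≡-Reasoning

[1+m]∸n≡[m∸n]+m/n : ∀ m n .{{_ : NonZero n}} → m < n + n → suc m ∸ n ≡ (m ∸ n) + m / n
[1+m]∸n≡[m∸n]+m/n m n m<2n with m ℕ.<? n
... | yes m<n = begin
  suc m ∸ n         ≡⟨ ℕ.m≤n⇒m∸n≡0 m<n ⟩
  0                 ≡⟨ cong₂ _+_ (ℕ.m≤n⇒m∸n≡0 (ℕ.<⇒≤ m<n)) (ℕ.m<n⇒m/n≡0 m<n) ⟨
  (m ∸ n) + m / n   ∎
  where open ≡-Reasoning
... | no m≮n = begin
  suc m ∸ n         ≡⟨ ℕ.+-∸-assoc 1 n≤m ⟩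
  suc (m ∸ n)       ≡⟨ ℕ.+-comm 1 (m ∸ n) ⟩
  (m ∸ n) + 1       ≡⟨ cong (_+_ (m ∸ n)) m/n≡1 ⟨
  (m ∸ n) + m / n   ∎
  where
  open ≡-Reasoning
  n≤m : n ≤ m
  n≤m = ℕ.≮⇒≥ m≮n
  m/n≡1 : m / n ≡ 1
  m/n≡1 = trans (ℕ.m/n≡1+[m∸n]/n n≤m) (cong suc (ℕ.m<n⇒m/n≡0 (ℕ.m<n+o⇒m∸n<o m n m<2n)))

sumTo-[m+i]/n : ∀ m n j .{{_ : NonZero n}} → j ≤ n →
                sumTo j (λ i → (m + i) / n) ≡ j * (m / n) + (m % n + j ∸ n)
sumTo-[m+i]/n m n zero    _     =
  sym (ℕ.m≤n⇒m∸n≡0 (subst (_≤ n) (sym (ℕ.+-identityʳ (m % n))) (ℕ.m%n≤n m n)))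
sumTo-[m+i]/n m n (suc j) 1+j≤n = begin
  sumTo j (λ i → (m + i) / n) + (m + j) / n
    ≡⟨ cong₂ _+_ (sumTo-[m+i]/n m n j (ℕ.<⇒≤ 1+j≤n)) ([m+i]/n≡m/n+[m%n+i]/n m j n) ⟩
  (j * q + (r + j ∸ n)) + (q + (r + j) / n)
    ≡⟨ interchange (j * q) (r + j ∸ n) q ((r + j) / n) ⟩
  (j * q + q) + ((r + j ∸ n) + (r + j) / n)
    ≡⟨ cong₂ _+_ (ℕ.+-comm q (j * q)) ([1+m]∸n≡[m∸n]+m/n (r + j) n r+j<2n) ⟨
  (q + j * q) + (suc (r + j) ∸ n)
    ≡⟨ cong (λ k → (q + j * q) + (k ∸ n)) (ℕ.+-suc r j) ⟨
  (q + j * q) + (r + suc j ∸ n)  ∎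
  where
  open ≡-Reasoning
  q r : ℕ
  q = m / n
  r = m % n
  r+j<2n : r + j < n + n
  r+j<2n = ℕ.+-mono-< (ℕ.m%n<n m n) 1+j≤n

[1+m/n]*n≡m+[n∸m%n] : ∀ m n .{{_ : NonZero n}} → suc (m / n) * n ≡ m + (n ∸ m % n)
[1+m/n]*n≡m+[n∸m%n] m n = begin
  n + m / n * n                    ≡⟨ cong (_+ m / n * n) (ℕ.m+[n∸m]≡n (ℕ.m%n≤n m n)) ⟨
  m % n + (n ∸ m % n) + m / n * n  ≡⟨ xy∙z≈xz∙y (m % n) (n ∸ m % n) (m / n * n) ⟩
  m % n + m / n * n + (n ∸ m % n)  ≡⟨ cong (_+ (n ∸ m % n)) (ℕ.m≡m%n+[m/n]*n m n) ⟨
  m + (n ∸ m % n)                  ∎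
  where open ≡-Reasoning

m+m≤n+n⇒m≤n : ∀ {m n} → m + m ≤ n + n → m ≤ n
m+m≤n+n⇒m≤n m+m≤n+n = ℕ.≮⇒≥ (λ n<m → ℕ.<⇒≱ (ℕ.+-mono-< n<m n<m) m+m≤n+n)

[m∸n]+[m∸n]+[n+n∸m]≡m : ∀ m n → n ≤ m → m ≤ n + n → (m ∸ n) + (m ∸ n) + (n + n ∸ m) ≡ m
[m∸n]+[m∸n]+[n+n∸m]≡m m n n≤m m≤2n = begin
  e + e + (n + n ∸ m)        ≡⟨ cong (λ k → e + e + (n + n ∸ k)) m≡n+e ⟩
  e + e + (n + n ∸ (n + e))  ≡⟨ cong (_+_ (e + e)) (ℕ.[m+n]∸[m+o]≡n∸o n n e) ⟩
  e + e + (n ∸ e)            ≡⟨ ℕ.+-assoc e e (n ∸ e) ⟩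
  e + (e + (n ∸ e))          ≡⟨ cong (_+_ e) (ℕ.m+[n∸m]≡n (ℕ.m≤n+o⇒m∸n≤o m n m≤2n)) ⟩
  e + n                      ≡⟨ ℕ.+-comm e n ⟩
  n + e                      ≡⟨ m≡n+e ⟨
  m                          ∎
  where
  open ≡-Reasoning
  e : ℕ
  e = m ∸ n
  m≡n+e : m ≡ n + e
  m≡n+e = sym (ℕ.m+[n∸m]≡n n≤m)

m*q≡n*p⇒m/p≡n/q : ∀ m p n q → m * suc q ≡ n * suc p → m / suc p ≡ n / suc q
m*q≡n*p⇒m/p≡n/q m p n q m*q≡n*p = begin
  m / suc p                   ≡⟨ ℕ.m*n/o*n≡m/o m (suc q) (suc p) ⟨
  m * suc q / (suc p * suc q) ≡⟨ ℕ./-congˡ m*q≡n*p ⟩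
  n * suc p / (suc p * suc q) ≡⟨ ℕ./-congʳ {m = n * suc p} (ℕ.*-comm (suc p) (suc q)) ⟩
  n * suc p / (suc q * suc p) ≡⟨ ℕ.m*n/o*n≡m/o n (suc p) (suc q) ⟩
  n / suc q                   ∎
  where open ≡-Reasoning

m*q≡n*p⇒[m%p]*q≡[n%q]*p : ∀ m p n q → m * suc q ≡ n * suc p → m % suc p * suc q ≡ n % suc q * suc p
m*q≡n*p⇒[m%p]*q≡[n%q]*p m p n q m*q≡n*p = begin
  m % suc p * suc q           ≡⟨ ℕ.m%n*o≡m*o%[n*o] m (suc p) (suc q) ⟩
  m * suc q % (suc p * suc q) ≡⟨ ℕ.%-congˡ m*q≡n*p ⟩
  n * suc p % (suc p * suc q) ≡⟨ ℕ.%-congʳ {o = n * suc p} (ℕ.*-comm (suc p) (suc q)) ⟩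
  n * suc p % (suc q * suc p) ≡⟨ ℕ.m%n*o≡m*o%[n*o] n (suc q) (suc p) ⟨
  n % suc q * suc p           ∎
  where open ≡-Reasoning

m*q≡n*p⇒n%q≡0⇒m%p≡0 : ∀ m p n q → m * suc q ≡ n * suc p → n % suc q ≡ 0 → m % suc p ≡ 0
m*q≡n*p⇒n%q≡0⇒m%p≡0 m p n q m*q≡n*p n%q≡0 = ℕ.m*n≡0⇒m≡0 (m % suc p) (suc q)
  (trans (m*q≡n*p⇒[m%p]*q≡[n%q]*p m p n q m*q≡n*p) (cong (_* suc p) n%q≡0))

+m*+n≡+o*+p⇒m*n≡o*p : ∀ m n o p → + m ℤ.* + n ≡ + o ℤ.* + p → m * n ≡ o * p
+m*+n≡+o*+p⇒m*n≡o*p m n o p eq = ℤ.+-injective (begin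
  + (m * n)    ≡⟨ ℤ.pos-* m n ⟩
  + m ℤ.* + n  ≡⟨ eq ⟩
  + o ℤ.* + p  ≡⟨ ℤ.pos-* o p ⟨
  + (o * p)    ∎)
  where open ≡-Reasoning

-[-[1+m]/n]≡[1+m]/n : ∀ m n → suc m % suc n ≡ 0 → ℤ.- (-[1+ m ] ℤ./ℕ suc n) ≡ + (suc m / suc n)
-[-[1+m]/n]≡[1+m]/n m n _ with suc m % suc n
... | zero = ℤ.neg-involutive _

-[-[1+m]/n]≡1+[1+m]/n : ∀ m n → suc m % suc n ≢ 0 → ℤ.- (-[1+ m ] ℤ./ℕ suc n) ≡ + suc (suc m / suc n)
-[-[1+m]/n]≡1+[1+m]/n m n [1+m]%n≢0 with suc m % suc n
... | zero  = contradiction refl [1+m]%n≢0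
... | suc _ = refl

-- The hypothesis is p = n / (1 + m) cross-multiplied; it rules out a negative numerator.
floor-≃-/ : ∀ p n m → ↥ p ℤ.* + suc m ≡ + n ℤ.* ↧ p → floor p ≡ + (n / suc m)
floor-≃-/ (mkℚ (+ a) d _) n m eq = trans (ℤ.div-pos-is-/ℕ (+ a) (suc d))
  (cong +_ (m*q≡n*p⇒m/p≡n/q a d n m (+m*+n≡+o*+p⇒m*n≡o*p a (suc m) n (suc d) eq)))
floor-≃-/ (mkℚ -[1+ a ] d _) n m eq with trans eq (sym (ℤ.pos-* n (suc d)))
... | ()

ceiling-≃-/-∣ : ∀ p n m → ↥ p ℤ.* + suc m ≡ + n ℤ.* ↧ p → n % suc m ≡ 0 →
                ceiling p ≡ + (n / suc m)
ceiling-≃-/-∣ (mkℚ (+ zero) d _) n m eq _ = cong (λ k → + (k / suc m)) (sym n≡0)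
  where
  n≡0 : n ≡ 0
  n≡0 = ℕ.m*n≡0⇒m≡0 n (suc d) (sym (+m*+n≡+o*+p⇒m*n≡o*p 0 (suc m) n (suc d) eq))
ceiling-≃-/-∣ (mkℚ (+ suc a) d _) n m eq n%M≡0 = begin
  ℤ.- (-[1+ a ] ℤ./ + suc d)
    ≡⟨ cong ℤ.-_ (ℤ.div-pos-is-/ℕ -[1+ a ] (suc d)) ⟩
  ℤ.- (-[1+ a ] ℤ./ℕ suc d)
    ≡⟨ -[-[1+m]/n]≡[1+m]/n a d (m*q≡n*p⇒n%q≡0⇒m%p≡0 (suc a) d n m a*M≡n*D n%M≡0) ⟩
  + (suc a / suc d)
    ≡⟨ cong +_ (m*q≡n*p⇒m/p≡n/q (suc a) d n m a*M≡n*D) ⟩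
  + (n / suc m)               ∎
  where
  open ≡-Reasoning
  a*M≡n*D : suc a * suc m ≡ n * suc d
  a*M≡n*D = +m*+n≡+o*+p⇒m*n≡o*p (suc a) (suc m) n (suc d) eq
ceiling-≃-/-∣ (mkℚ -[1+ a ] d _) n m eq _ with trans eq (sym (ℤ.pos-* n (suc d)))
... | ()

ceiling-≃-/-∤ : ∀ p n m → ↥ p ℤ.* + suc m ≡ + n ℤ.* ↧ p → n % suc m ≢ 0 →
                ceiling p ≡ + suc (n / suc m)
ceiling-≃-/-∤ (mkℚ (+ zero) d _) n m eq n%M≢0 = contradiction (cong (_% suc m) n≡0) n%M≢0
  where
  n≡0 : n ≡ 0
  n≡0 = ℕ.m*n≡0⇒m≡0 n (suc d) (sym (+m*+n≡+o*+p⇒m*n≡o*p 0 (suc m) n (suc d) eq))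
ceiling-≃-/-∤ (mkℚ (+ suc a) d _) n m eq n%M≢0 = begin
  ℤ.- (-[1+ a ] ℤ./ + suc d)
    ≡⟨ cong ℤ.-_ (ℤ.div-pos-is-/ℕ -[1+ a ] (suc d)) ⟩
  ℤ.- (-[1+ a ] ℤ./ℕ suc d)
    ≡⟨ -[-[1+m]/n]≡1+[1+m]/n a d (n%M≢0 ∘ m*q≡n*p⇒n%q≡0⇒m%p≡0 n m (suc a) d (sym a*M≡n*D)) ⟩
  + suc (suc a / suc d)
    ≡⟨ cong (λ k → + suc k) (m*q≡n*p⇒m/p≡n/q (suc a) d n m a*M≡n*D) ⟩
  + suc (n / suc m)           ∎
  where
  open ≡-Reasoning
  a*M≡n*D : suc a * suc m ≡ n * suc d
  a*M≡n*D = +m*+n≡+o*+p⇒m*n≡o*p (suc a) (suc m) n (suc d) eq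
ceiling-≃-/-∤ (mkℚ -[1+ a ] d _) n m eq _ with trans eq (sym (ℤ.pos-* n (suc d)))
... | ()

toℚᵘ-/ : ∀ i m → toℚᵘ (i ℚ./ suc m) ≃ mkℚᵘ i m
toℚᵘ-/ i m = ℚ.toℚᵘ-fromℚᵘ (mkℚᵘ i m)

toℚᵘ-[i/1] : ∀ {i j} → i ≡ j → toℚᵘ (i ℚ./ 1) ≃ mkℚᵘ j 0
toℚᵘ-[i/1] {i} refl = toℚᵘ-/ i 0

toℚᵘ-homo-− : ∀ p q → toℚᵘ (p ℚ.- q) ≃ toℚᵘ p ℚᵘ.- toℚᵘ q
toℚᵘ-homo-− p q =
  ℚᵘ.≃-trans (ℚ.toℚᵘ-homo-+ p (ℚ.- q)) (ℚᵘ.+-congʳ (toℚᵘ p) (ℚ.toℚᵘ-homo‿- q))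

↥[n/M]*M≡n*↧[n/M] : ∀ n m → ↥ (+ n ℚ./ suc m) ℤ.* + suc m ≡ + n ℤ.* ↧ (+ n ℚ./ suc m)
↥[n/M]*M≡n*↧[n/M] n m with toℚᵘ-/ (+ n) m
... | *≡* eq = trans (cong (ℤ._* + suc m) (sym (ℚ.↥ᵘ-toℚᵘ (+ n ℚ./ suc m))))
                 (trans eq (cong (ℤ._*_ (+ n)) (ℚ.↧ᵘ-toℚᵘ (+ n ℚ./ suc m))))

≤-via-/ : ∀ {p q a b m} → toℚᵘ p ≃ mkℚᵘ (+ a) m → toℚᵘ q ≃ mkℚᵘ (+ b) m → a ≤ b → p ℚ.≤ q
≤-via-/ {a = a} {b} {m} p≃a/M q≃b/M a≤b = ℚ.toℚᵘ-cancel-≤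
  (ℚᵘ.≤-respˡ-≃ (ℚᵘ.≃-sym p≃a/M) (ℚᵘ.≤-respʳ-≃ (ℚᵘ.≃-sym q≃b/M)
    (*≤* (subst₂ ℤ._≤_ (ℤ.pos-* a (suc m)) (ℤ.pos-* b (suc m))
      (ℤ.+≤+ (ℕ.*-monoˡ-≤ (suc m) a≤b))))))

a/M-c≃b/M : ∀ a b c m → a ≡ b + c * suc m → mkℚᵘ (+ a) m ℚᵘ.- mkℚᵘ (+ c) 0 ≃ mkℚᵘ (+ b) m
a/M-c≃b/M a b c m a≡b+c*M = *≡* (begin
  (+ a ℤ.* + 1 ℤ.+ ℤ.- + c ℤ.* + suc m) ℤ.* + suc m
    ≡⟨ cong (λ i → (i ℤ.* + 1 ℤ.+ ℤ.- + c ℤ.* + suc m) ℤ.* + suc m) +a≡b+c*M ⟩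
  ((+ b ℤ.+ + c ℤ.* + suc m) ℤ.* + 1 ℤ.+ ℤ.- + c ℤ.* + suc m) ℤ.* + suc m
    ≡⟨ cancel (+ b) (+ c) (+ suc m) ⟩
  + b ℤ.* (+ suc m ℤ.* + 1) ∎)
  where
  open ≡-Reasoning
  cancel : ∀ b c M → ((b ℤ.+ c ℤ.* M) ℤ.* + 1 ℤ.+ ℤ.- c ℤ.* M) ℤ.* M ≡ b ℤ.* (M ℤ.* + 1)
  cancel = solve-∀
  +a≡b+c*M : + a ≡ + b ℤ.+ + c ℤ.* + suc m
  +a≡b+c*M = trans (cong +_ a≡b+c*M)
    (trans (ℤ.pos-+ b (c * suc m)) (cong (ℤ._+_ (+ b)) (ℤ.pos-* c (suc m))))

c-a/M≃b/M : ∀ a b c m → c * suc m ≡ a + b → mkℚᵘ (+ c) 0 ℚᵘ.- mkℚᵘ (+ a) m ≃ mkℚᵘ (+ b) m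
c-a/M≃b/M a b c m c*M≡a+b = *≡* (begin
  (+ c ℤ.* + suc m ℤ.+ ℤ.- + a ℤ.* + 1) ℤ.* + suc m
    ≡⟨ cong (λ i → (i ℤ.+ ℤ.- + a ℤ.* + 1) ℤ.* + suc m) +c*M≡a+b ⟩
  (+ a ℤ.+ + b ℤ.+ ℤ.- + a ℤ.* + 1) ℤ.* + suc m
    ≡⟨ cancel (+ a) (+ b) (+ suc m) ⟩
  + b ℤ.* + suc m
    ≡⟨ cong (λ k → + b ℤ.* + k) (ℕ.*-identityˡ (suc m)) ⟨
  + b ℤ.* + (1 * suc m)        ∎)
  where
  open ≡-Reasoning
  cancel : ∀ a b M → (a ℤ.+ b ℤ.+ ℤ.- a ℤ.* + 1) ℤ.* M ≡ b ℤ.* M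
  cancel = solve-∀
  +c*M≡a+b : + c ℤ.* + suc m ≡ + a ℤ.+ + b
  +c*M≡a+b = trans (sym (ℤ.pos-* c (suc m))) (trans (cong +_ c*M≡a+b) (ℤ.pos-+ a b))

module _ (n m : ℕ) where
  private
    M : ℕ
    M = suc m
    x : ℚ
    x = + n ℚ./ M
    x≃n/M : ↥ x ℤ.* + M ≡ + n ℤ.* ↧ x
    x≃n/M = ↥[n/M]*M≡n*↧[n/M] n m

  x-⌊x⌋≃[n%M]/M : toℚᵘ (x ℚ.- floor x ℚ./ 1) ≃ mkℚᵘ (+ (n % M)) m
  x-⌊x⌋≃[n%M]/M = begin
    toℚᵘ (x ℚ.- floor x ℚ./ 1)
      ≈⟨ toℚᵘ-homo-− x (floor x ℚ./ 1) ⟩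
    toℚᵘ x ℚᵘ.- toℚᵘ (floor x ℚ./ 1)
      ≈⟨ ℚᵘ.+-cong (toℚᵘ-/ (+ n) m) (ℚᵘ.-‿cong (toℚᵘ-[i/1] (floor-≃-/ x n m x≃n/M))) ⟩
    mkℚᵘ (+ n) m ℚᵘ.- mkℚᵘ (+ (n / M)) 0
      ≈⟨ a/M-c≃b/M n (n % M) (n / M) m (ℕ.m≡m%n+[m/n]*n n M) ⟩
    mkℚᵘ (+ (n % M)) m                     ∎
    where open ℚᵘ.≃-Reasoning

  ⌈x⌉-x≃0 : n % M ≡ 0 → toℚᵘ (ceiling x ℚ./ 1 ℚ.- x) ≃ mkℚᵘ (+ 0) m
  ⌈x⌉-x≃0 M∣n = begin
    toℚᵘ (ceiling x ℚ./ 1 ℚ.- x)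
      ≈⟨ toℚᵘ-homo-− (ceiling x ℚ./ 1) x ⟩
    toℚᵘ (ceiling x ℚ./ 1) ℚᵘ.- toℚᵘ x
      ≈⟨ ℚᵘ.+-cong (toℚᵘ-[i/1] (ceiling-≃-/-∣ x n m x≃n/M M∣n)) (ℚᵘ.-‿cong (toℚᵘ-/ (+ n) m)) ⟩
    mkℚᵘ (+ (n / M)) 0 ℚᵘ.- mkℚᵘ (+ n) m
      ≈⟨ c-a/M≃b/M n 0 (n / M) m q*M≡n+0 ⟩
    mkℚᵘ (+ 0) m                           ∎
    where
    open ℚᵘ.≃-Reasoning
    q*M≡n+0 : n / M * M ≡ n + 0
    q*M≡n+0 = trans (ℕ.m/n*n≡m (m%n≡0⇒n∣m n M M∣n)) (sym (ℕ.+-identityʳ n))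

  ⌈x⌉-x≃[M∸n%M]/M : n % M ≢ 0 → toℚᵘ (ceiling x ℚ./ 1 ℚ.- x) ≃ mkℚᵘ (+ (M ∸ n % M)) m
  ⌈x⌉-x≃[M∸n%M]/M M∤n = begin
    toℚᵘ (ceiling x ℚ./ 1 ℚ.- x)
      ≈⟨ toℚᵘ-homo-− (ceiling x ℚ./ 1) x ⟩
    toℚᵘ (ceiling x ℚ./ 1) ℚᵘ.- toℚᵘ x
      ≈⟨ ℚᵘ.+-cong (toℚᵘ-[i/1] (ceiling-≃-/-∤ x n m x≃n/M M∤n)) (ℚᵘ.-‿cong (toℚᵘ-/ (+ n) m)) ⟩
    mkℚᵘ (+ suc (n / M)) 0 ℚᵘ.- mkℚᵘ (+ n) m
      ≈⟨ c-a/M≃b/M n (M ∸ n % M) (suc (n / M)) m ([1+m/n]*n≡m+[n∸m%n] n M) ⟩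
    mkℚᵘ (+ (M ∸ n % M)) m                   ∎
    where open ℚᵘ.≃-Reasoning

  Zigzag-x≃[n%M]/M : n % M + n % M ≤ M → toℚᵘ (Zigzag x) ≃ mkℚᵘ (+ (n % M)) m
  Zigzag-x≃[n%M]/M r+r≤M =
    ℚᵘ.≃-trans (ℚ.toℚᵘ-cong (ℚ.p≤q⇒p⊓q≡p (x-⌊x⌋≤⌈x⌉-x (n % M ℕ.≟ 0)))) x-⌊x⌋≃[n%M]/M
    where
    x-⌊x⌋≤⌈x⌉-x : Dec (n % M ≡ 0) → x ℚ.- floor x ℚ./ 1 ℚ.≤ ceiling x ℚ./ 1 ℚ.- x
    x-⌊x⌋≤⌈x⌉-x (yes M∣n) = ≤-via-/ x-⌊x⌋≃[n%M]/M (⌈x⌉-x≃0 M∣n) (ℕ.≤-reflexive M∣n)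
    x-⌊x⌋≤⌈x⌉-x (no M∤n)  = ≤-via-/ x-⌊x⌋≃[n%M]/M (⌈x⌉-x≃[M∸n%M]/M M∤n)
      (subst (_≤ M ∸ n % M) (ℕ.m+n∸n≡m (n % M) (n % M)) (ℕ.∸-monoˡ-≤ (n % M) r+r≤M))

  Zigzag-x≃[M∸n%M]/M : M < n % M + n % M → toℚᵘ (Zigzag x) ≃ mkℚᵘ (+ (M ∸ n % M)) m
  Zigzag-x≃[M∸n%M]/M M<r+r =
    ℚᵘ.≃-trans (ℚ.toℚᵘ-cong (ℚ.p≥q⇒p⊓q≡q ⌈x⌉-x≤x-⌊x⌋)) (⌈x⌉-x≃[M∸n%M]/M M∤n)
    where
    M∤n : n % M ≢ 0
    M∤n r≡0 = ℕ.n≮0 (subst (λ r → M < r + r) r≡0 M<r+r)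
    ⌈x⌉-x≤x-⌊x⌋ : ceiling x ℚ./ 1 ℚ.- x ℚ.≤ x ℚ.- floor x ℚ./ 1
    ⌈x⌉-x≤x-⌊x⌋ = ≤-via-/ (⌈x⌉-x≃[M∸n%M]/M M∤n) x-⌊x⌋≃[n%M]/M
      (ℕ.m≤n+o⇒m∸n≤o M (n % M) (ℕ.<⇒≤ M<r+r))

S≡n/2-h*Z : ∀ S h t n m Z → suc m ≡ h + h → S + S + t ≡ n → toℚᵘ Z ≃ mkℚᵘ (+ t) m →
            + S ℚ./ 1 ≡ + n ℚ./ 2 ℚ.- (+ h ℚ./ 1) ℚ.* Z
S≡n/2-h*Z S h t _ m Z M≡h+h refl Z≃t/M = ℚ.toℚᵘ-injective (begin
  toℚᵘ (+ S ℚ./ 1)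
    ≈⟨ toℚᵘ-/ (+ S) 0 ⟩
  mkℚᵘ (+ S) 0
    ≈⟨ *≡* cross-multiplied ⟩
  mkℚᵘ (+ (S + S + t)) 1 ℚᵘ.- mkℚᵘ (+ h) 0 ℚᵘ.* mkℚᵘ (+ t) m
    ≈⟨ ℚᵘ.+-cong (toℚᵘ-/ (+ (S + S + t)) 1) (ℚᵘ.-‿cong h*Z≃h*t/M) ⟨
  toℚᵘ n/2 ℚᵘ.- toℚᵘ ((+ h ℚ./ 1) ℚ.* Z)
    ≈⟨ toℚᵘ-homo-− n/2 ((+ h ℚ./ 1) ℚ.* Z) ⟨
  toℚᵘ (n/2 ℚ.- (+ h ℚ./ 1) ℚ.* Z)  ∎)
  where
  open ℚᵘ.≃-Reasoning
  n/2 : ℚ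
  n/2 = + (S + S + t) ℚ./ 2
  h*Z≃h*t/M : toℚᵘ ((+ h ℚ./ 1) ℚ.* Z) ≃ mkℚᵘ (+ h) 0 ℚᵘ.* mkℚᵘ (+ t) m
  h*Z≃h*t/M = ℚᵘ.≃-trans (ℚ.toℚᵘ-homo-* (+ h ℚ./ 1) Z) (ℚᵘ.*-cong (toℚᵘ-/ (+ h) 0) Z≃t/M)
  +M≡h+h : + (1 * suc m) ≡ + h ℤ.+ + h
  +M≡h+h = trans (cong +_ (trans (ℕ.*-identityˡ (suc m)) M≡h+h)) (ℤ.pos-+ h h)
  +[S+S+t] : + (S + S + t) ≡ + S ℤ.+ + S ℤ.+ + t
  +[S+S+t] = trans (ℤ.pos-+ (S + S) t) (cong (ℤ._+ + t) (ℤ.pos-+ S S))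
  identity : ∀ S h t → S ℤ.* (+ 2 ℤ.* (h ℤ.+ h))
                     ≡ ((S ℤ.+ S ℤ.+ t) ℤ.* (h ℤ.+ h) ℤ.+ ℤ.- (h ℤ.* t) ℤ.* + 2) ℤ.* + 1
  identity = solve-∀
  cross-multiplied : + S ℤ.* + (2 * (1 * suc m))
                   ≡ (+ (S + S + t) ℤ.* + (1 * suc m) ℤ.+ ℤ.- (+ h ℤ.* + t) ℤ.* + 2) ℤ.* + 1
  cross-multiplied =
    trans (cong (ℤ._*_ (+ S)) (trans (ℤ.pos-* 2 (1 * suc m)) (cong (ℤ._*_ (+ 2)) +M≡h+h)))
    (trans (identity (+ S) (+ h) (+ t))
      (cong₂ (λ a b → (a ℤ.* b ℤ.+ ℤ.- (+ h ℤ.* + t) ℤ.* + 2) ℤ.* + 1) (sym +[S+S+t]) (sym +M≡h+h)))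

module _ (n h m : ℕ) (M≡h+h : suc m ≡ h + h) where
  private
    M q r S : ℕ
    M = suc m
    q = n / M
    r = n % M
    S = sumTo h (λ i → (n + i) / M)

  S≡h*q+[r∸h] : S ≡ h * q + (r ∸ h)
  S≡h*q+[r∸h] = trans (sumTo-[m+i]/n n M h h≤M) (cong (_+_ (h * q)) r+h∸M≡r∸h)
    where
    h≤M : h ≤ M
    h≤M = subst (h ≤_) (sym M≡h+h) (ℕ.m≤n+m h h)
    r+h∸M≡r∸h : r + h ∸ M ≡ r ∸ h
    r+h∸M≡r∸h = trans (cong₂ _∸_ (ℕ.+-comm r h) M≡h+h) (ℕ.[m+n]∸[m+o]≡n∸o h r h)

  S+S+t≡n : ∀ t → (r ∸ h) + (r ∸ h) + t ≡ r → S + S + t ≡ n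
  S+S+t≡n t 2e+t≡r = begin
    S + S + t                                       ≡⟨ cong (λ s → s + s + t) S≡h*q+[r∸h] ⟩
    (h * q + (r ∸ h)) + (h * q + (r ∸ h)) + t       ≡⟨ regroup h q (r ∸ h) t ⟩
    ((r ∸ h) + (r ∸ h) + t) + q * (h + h)           ≡⟨ cong₂ (λ a b → a + q * b) 2e+t≡r (sym M≡h+h) ⟩
    r + q * M                                       ≡⟨ ℕ.m≡m%n+[m/n]*n n M ⟨
    n                                               ∎
    where
    open ≡-Reasoning
    regroup : ∀ h q e t → (h * q + e) + (h * q + e) + t ≡ (e + e + t) + q * (h + h)
    regroup = ℕ.solve-∀

sumTo[[n+i]/M]≡n/2-h*Zigzag[n/M] : ∀ n h M .{{_ : NonZero M}} → M ≡ h + h →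
  + sumTo h (λ i → (n + i) / M) ℚ./ 1 ≡ + n ℚ./ 2 ℚ.- (+ h ℚ./ 1) ℚ.* Zigzag (+ n ℚ./ M)
sumTo[[n+i]/M]≡n/2-h*Zigzag[n/M] n h (suc m) M≡h+h with n % suc m + n % suc m ℕ.≤? suc m
... | yes r+r≤M = S≡n/2-h*Z S h r n m _ M≡h+h
  (S+S+t≡n n h m M≡h+h r (cong (λ e → e + e + r) (ℕ.m≤n⇒m∸n≡0 r≤h)))
  (Zigzag-x≃[n%M]/M n m r+r≤M)
  where
  S r : ℕ
  S = sumTo h (λ i → (n + i) / suc m)
  r = n % suc m
  r≤h : r ≤ h
  r≤h = m+m≤n+n⇒m≤n (subst (r + r ≤_) M≡h+h r+r≤M)
... | no r+r≰M = S≡n/2-h*Z S h (suc m ∸ r) n m _ M≡h+h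
  (S+S+t≡n n h m M≡h+h (suc m ∸ r) (trans (cong (λ M → (r ∸ h) + (r ∸ h) + (M ∸ r)) M≡h+h)
    ([m∸n]+[m∸n]+[n+n∸m]≡m r h h≤r (subst (r ≤_) M≡h+h (ℕ.m%n≤n n (suc m))))))
  (Zigzag-x≃[M∸n%M]/M n m M<r+r)
  where
  S r : ℕ
  S = sumTo h (λ i → (n + i) / suc m)
  r = n % suc m
  M<r+r : suc m < r + r
  M<r+r = ℕ.≰⇒> r+r≰M
  h≤r : h ≤ r
  h≤r = m+m≤n+n⇒m≤n (subst (_≤ r + r) M≡h+h (ℕ.<⇒≤ M<r+r))

corollary2p4 : (n k : ℕ) →
    (+ sumTo (2 ^ k) (λ i → _/_ (n + i) (2 ^ (k + 1)) ⦃ m^n≢0 2 (k + 1) ⦄) ℚ./ 1)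
      ≡ (+ n ℚ./ 2) ℚ.- ((+ (2 ^ k) ℚ./ 1) ℚ.* Zigzag (ℚ._/_ (+ n) (2 ^ (k + 1)) ⦃ m^n≢0 2 (k + 1) ⦄))
corollary2p4 n k =
  sumTo[[n+i]/M]≡n/2-h*Zigzag[n/M] n (2 ^ k) (2 ^ (k + 1)) ⦃ m^n≢0 2 (k + 1) ⦄ 2^[k+1]≡2^k+2^k
  where
  2^[k+1]≡2^k+2^k : 2 ^ (k + 1) ≡ 2 ^ k + 2 ^ k
  2^[k+1]≡2^k+2^k = trans (cong (2 ^_) (ℕ.+-comm k 1)) (cong (_+_ (2 ^ k)) (ℕ.+-identityʳ (2 ^ k)))
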